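{- Let $G$ be a finite simple graph and $X_0,X_1,\dots,X_{k+1}$ a nice path decomposition of $G$. The set $S$ returned by the Zero Forcing Set Algorithm (described in the context) on input $G$ and this decomposition is a zero forcing set for $G$.
   Context: Zero forcing: vertices are blue or white; a blue vertex $u$ may force a white neighbour $v$ if $v$ is the only white vertex in $N[u]$; a zero forcing set of a graph is an initial blue set from which all vertices eventually become blue. An arc set of a graph $H=(U,F)$ is a set of ordered pairs $(u,v)$ with $uv\in F$, not containing both $(u,v)$ and $(v,u)$; it is a forcing arc set if it is a collection of vertex-disjoint directed paths and there is a zero forcing process on $H$ starting from its sources (in-degree zero vertices), each white vertex forced by exactly one vertex and all vertices ending blue, such that $(u,v)$ is an arc exactly when $u$ forces $v$. $\overleftarrow{A}=\{(v,u):(u,v)\in A\}$. A nice path decomposition of $G=(V,E)$ is a sequence $X_0,\dots,X_{k+1}\subseteq V$ with (D1) every edge contained in some $X_i$, $1\le i\le k$; (D2) if $v\in X_i\cap X_j$, $i<j$, then $v\in X_s$ for $i\le s\le j$; (D3) $X_0=X_{k+1}=\emptyset$, other $X_i$ nonempty; (D4) consecutive sets differ by adding or deleting exactly one vertex; and, as for any path decomposition, every vertex of $G$ lies in some $X_i$. Notation: $X_i^j=\bigcup_{\tau=i}^jX_\tau$, $G(i,j)=G[X_i^j]$; $\mathsf{White}(S,H)$ is the set of vertices of $H$ still white when the zero forcing process on $H$ from initial blue set $S$ can no longer force; $\mathsf{FAS}(S,H)$ is a fixed (canonically chosen) forcing arc set representing the zero forcing process on $H$ from $S$ (with arcs $(u,v)$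 for each force $u\to v$); $\mathsf{Sources}(A,U)$ is the set of vertices of $U$ of in-degree zero in $(U,A)$. The Zero Forcing Set Algorithm: (L1) set $t\leftarrow0$, $S\leftarrow\emptyset$, $A\leftarrow\emptyset$, $\mathcal F\leftarrow\emptyset$. (L2) set $z\leftarrow t$, $W\leftarrow\emptyset$. (L3) while $W=\emptyset$ and $z\le k$: set $z\leftarrow z+1$ and $W\leftarrow\mathsf{White}(X_t\cup X_z,G(t,z))$. (L4) set $A\leftarrow\overleftarrow{A}$. (L5) set $S\leftarrow\mathsf{Sources}(A,X_0^t)$. (L6) if $W\ne\emptyset$: add $W$ to $\mathcal F$; set $S\leftarrow S\cup X_{z-1}$; set $A'\leftarrow A\cup\mathsf{FAS}(X_t\cup X_{z-1},G(t,z))$; set $A\leftarrow\{(u,v)\in A':v\notin X_z\}$; set $t\leftarrow z$ and go to (L2). (L7) if $W=\emptyset$: set $A\leftarrow A\cup\mathsf{FAS}(X_t,G(t,z))$. (L8) return $S$ and $\mathcal F$. -}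

module Defs where

open import Data.Nat using (ℕ; zero; suc; _+_; _∸_; _≤_; _≤ᵇ_)
open import Data.Bool using (Bool; true; false; not; _∧_; _∨_; if_then_else_)
open import Data.Fin using (Fin; _≟_)
open import Data.Fin.Subset using (Subset; ⊥; ⁅_⁆; _∈_; _∉_; ∁; _∩_; _∪_; Nonempty)
open import Data.Vec using (lookup; tabulate)
open import Data.List using (List; []; _∷_; _++_; allFin)
open import Data.Bool.ListAction using (any; all)
open import Data.List.Membership.Propositional using () renaming (_∈_ to _∈ˡ_)
open import Data.Product using (Σ; ∃; _×_; _,_; proj₁; proj₂)
open import Data.Sum using (_⊎_)
open import Relation.Nullary using (¬_; does)
open import Relation.Binary.PropositionalEquality using (_≡_; _≢_)
open import Function.Bundles using (_⇔_)

record Graph (n : ℕ) : Set where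
  field
    adj    : Fin n → Fin n → Bool
    sym    : ∀ u v → adj u v ≡ adj v u
    irrefl : ∀ u → adj u u ≡ false
open Graph public

data Blue {n : ℕ} (G : Graph n) (S : Subset n) : Fin n → Set where
  init  : ∀ {v} → v ∈ S → Blue G S v
  force : ∀ {u v} → Blue G S u → adj G u v ≡ true →
          (∀ w → adj G u w ≡ true → w ≢ v → Blue G S w) →
          Blue G S v

ZeroForcingSet : ∀ {n} → Graph n → Subset n → Set
ZeroForcingSet G S = ∀ v → Blue G S v

ValidForce : ∀ {n} → Graph n → (U B : Subset n) → Fin n → Fin n → Set
ValidForce G U B u v =
  u ∈ U × v ∈ U × u ∈ B × v ∉ B × adj G u v ≡ true ×
  (∀ w → w ∈ U → adj G u w ≡ true → w ≢ v → w ∈ B)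

data ForcingProcess {n : ℕ} (G : Graph n) (U : Subset n) :
       Subset n → List (Fin n × Fin n) → Set where
  done : ∀ {B} → (∀ u v → ¬ ValidForce G U B u v) → ForcingProcess G U B []
  step : ∀ {B u v fs} → ValidForce G U B u v →
         ForcingProcess G U (B ∪ ⁅ v ⁆) fs →
         ForcingProcess G U B ((u , v) ∷ fs)

Arcs : ℕ → Set
Arcs n = Fin n → Fin n → Bool

-- Specification of FAS(S, G[U]): an arc set whose arcs are exactly the forces
-- (u , v) of a (maximal) zero forcing process on G[U] started from S.
FASSpec : ∀ {n} → Graph n → (Subset n → Subset n → Arcs n) → Set
FASSpec {n} G fas = ∀ (S U : Subset n) →
  ∃ λ (fs : List (Fin n × Fin n)) →
    ForcingProcess G U (S ∩ U) fs ×
    (∀ u v → (fas S U u v ≡ true) ⇔ ((u , v) ∈ˡ fs))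

-- Nice path decompositions, X : ℕ → Subset n (indices 0 … k+1 relevant)

NicePathDecomposition : ∀ {n} → Graph n → ℕ → (ℕ → Subset n) → Set
NicePathDecomposition {n} G k X =
  (∀ u v → adj G u v ≡ true →
     ∃ λ i → 1 ≤ i × i ≤ k × u ∈ X i × v ∈ X i) ×
  (∀ v i j s → i ≤ s → s ≤ j → j ≤ suc k → v ∈ X i → v ∈ X j → v ∈ X s) ×
  (X 0 ≡ ⊥) × (X (suc k) ≡ ⊥) ×
  (∀ i → 1 ≤ i → i ≤ k → Nonempty (X i)) ×
  (∀ i → i ≤ k → ∃ λ v →
     (v ∉ X i × X (suc i) ≡ X i ∪ ⁅ v ⁆) ⊎
     (v ∉ X (suc i) × X i ≡ X (suc i) ∪ ⁅ v ⁆)) ×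
  (∀ v → ∃ λ i → i ≤ suc k × v ∈ X i)

anyV : ∀ {n} → (Fin n → Bool) → Bool
anyV {n} p = any p (allFin n)

allV : ∀ {n} → (Fin n → Bool) → Bool
allV {n} p = all p (allFin n)

isNonEmpty : ∀ {n} → Subset n → Bool
isNonEmpty W = anyV (λ v → lookup W v)

bagUnion : ∀ {n} → (ℕ → Subset n) → ℕ → ℕ → Subset n
bagUnion X i zero    = X i
bagUnion X i (suc m) = bagUnion X i m ∪ X (i + suc m)

-- X_i^j  (used only with i ≤ j)
bags : ∀ {n} → (ℕ → Subset n) → ℕ → ℕ → Subset n
bags X i j = bagUnion X i (j ∸ i)

canForce : ∀ {n} → Graph n → (U B : Subset n) → Fin n → Fin n → Bool
canForce G U B u v =
  lookup U u ∧ lookup U v ∧ lookup B u ∧ not (lookup B v) ∧ adj G u v ∧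
  allV (λ w → not (lookup U w ∧ adj G u w ∧ not (does (w ≟ v))) ∨ lookup B w)

forceRound : ∀ {n} → Graph n → (U B : Subset n) → Subset n
forceRound G U B = tabulate (λ v → lookup B v ∨ anyV (λ u → canForce G U B u v))

iterate : ∀ {A : Set} → ℕ → (A → A) → A → A
iterate zero    f a = a
iterate (suc m) f a = iterate m f (f a)

-- White(S, G[U]): vertices of G[U] still white when forcing from S stops
-- (n rounds suffice, since each non-final round blues a new vertex).
White : ∀ {n} → Graph n → (S U : Subset n) → Subset n
White {n} G S U = U ∩ ∁ (iterate n (forceRound G U) (S ∩ U))

reverseArcs : ∀ {n} → Arcs n → Arcs n
reverseArcs A u v = A v u

unionArcs : ∀ {n} → Arcs n → Arcs n → Arcs n
unionArcs A B u v = A u v ∨ B u v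

noArcs : ∀ {n} → Arcs n
noArcs u v = false

Sources : ∀ {n} → Arcs n → Subset n → Subset n
Sources A U = tabulate (λ u → lookup U u ∧ not (anyV (λ w → lookup U w ∧ A w u)))

module Algorithm {n : ℕ} (G : Graph n) (k : ℕ) (X : ℕ → Subset n)
                 (fas : Subset n → Subset n → Arcs n) where

  -- (L3): while W = ∅ and z ≤ k: z ← z+1, W ← White(X_t ∪ X_z, G(t,z)).
  -- Fuel suc k is never exhausted (z only grows from t up to k+1).
  loopL3 : ℕ → (t z : ℕ) → Subset n → ℕ × Subset n
  loopL3 zero       t z W = z , W
  loopL3 (suc fuel) t z W =
    if isNonEmpty W ∨ not (z ≤ᵇ k) then (z , W)
    else loopL3 fuel t (suc z) (White G (X t ∪ X (suc z)) (bags X t (suc z)))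

  -- One pass of (L2)–(L7), looping back to (L2) from (L6).
  -- Fuel suc (suc k) is never exhausted (t strictly increases, t ≤ k+1).
  run : ℕ → (t : ℕ) → Arcs n → Subset n → List (Subset n) →
        Subset n × List (Subset n)
  run zero       t A S F = S , F
  run (suc fuel) t A S F =
    let zW = loopL3 (suc k) t t ⊥
        z  = proj₁ zW
        W  = proj₂ zW
        A₁ = reverseArcs A
        S₁ = Sources A₁ (bags X 0 t)
    in if isNonEmpty W
       then (let F₂ = F ++ (W ∷ [])
                 S₂ = S₁ ∪ X (z ∸ 1)
                 A' = unionArcs A₁ (fas (X t ∪ X (z ∸ 1)) (bags X t z))
                 A₂ = λ u v → A' u v ∧ not (lookup (X z) v)
             in run fuel z A₂ S₂ F₂)
       else (S₁ , F)
       -- (L7)'s update of A does not affect the returned S and 𝓕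

  zfsAlgorithm : Subset n × List (Subset n)
  zfsAlgorithm = run (suc (suc k)) 0 noArcs ⊥ []

open Algorithm public using (zfsAlgorithm)

-- The algorithm maintains a forcing process on G[X₀ ∪ … ∪ X_t] whose initial
-- blue set is exactly its set of sources, and none of whose arcs ends in X_t.
-- Reversing such a process gives another one (the reversal theorem for forcing
-- arc sets).  Gluing the reversed process to the process computed on G(t,z),
-- which starts from X_t ⊇ X₀^t ∩ X_t^z and therefore never forces a vertex of
-- X₀^t, gives a process on G[X₀^z]; cutting the arcs into X_z restores the
-- invariant, whose new sources are the vertices of X_z that lost their forcer.
-- Since X_t separates X₀^t from the later bags, the sources S of the final
-- reversed process force all of X₀^t, hence X_t, in G itself, and the empty
-- White set of the last round says that X_t then forces everything else.

module Submission where

open import Defs hiding (sym)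
open import Data.Nat using (ℕ; zero; suc; _+_; _∸_; _≤_; _<_; _≤ᵇ_; z≤n; s≤s; s≤s⁻¹; _≤?_)
open import Data.Nat.Properties hiding (_≟_)
open import Data.Bool using (Bool; true; false; not; _∧_; _∨_; if_then_else_) renaming (_≟_ to _≟ᴮ_)
open import Data.Bool.Properties using (∧-zeroʳ; ∨-zeroʳ; ¬-not; T-≡; not-injective)
open import Data.Fin using (Fin; _≟_)
open import Data.Fin.Properties using (any?)
open import Data.Fin.Subset using (Subset; ⊥; ⁅_⁆; _∈_; _∉_; _∩_; _∪_)
open import Data.Fin.Subset.Properties
  using (∉⊥; x∈⁅x⁆; x∉∁p⇒x∈p; x∈⁅y⁆⇒x≡y; x∈p∪q⁺; x∈p∪q⁻; x∈p∩q⁺; x∈p∩q⁻)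
open import Data.Vec using (lookup)
open import Data.Vec.Properties using (lookup-replicate; lookup∘tabulate; []=⇒lookup; lookup⇒[]=)
open import Data.List using ([]; _∷_; _++_; allFin)
open import Data.List.Membership.Propositional using (lose) renaming (_∈_ to _∈ˡ_)
open import Data.List.Membership.Propositional.Properties using (∈-allFin)
open import Data.List.Relation.Unary.Any using (here; there; satisfied)
open import Data.List.Relation.Unary.Any.Properties using (any⁺; any⁻)
open import Data.List.Relation.Unary.All using () renaming (lookup to All-lookup)
open import Data.List.Relation.Unary.All.Properties using (all⁺)
open import Data.Product using (∃; _×_; _,_; proj₁; proj₂)
open import Data.Sum using (_⊎_; inj₁; inj₂)
open import Data.Empty using (⊥-elim)
open import Relation.Nullary using (¬_; does; yes; no; contradiction)
open import Relation.Nullary.Decidable using (dec-true; dec-false)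
open import Relation.Binary.PropositionalEquality
  using (_≡_; _≢_; refl; sym; trans; cong; cong₂; subst; subst₂)
open import Function.Base using (_∘_)
open import Function.Bundles using (_⇔_; Equivalence)
open import Function.Construct.Symmetry using (⇔-sym)

∧-true⁻ : ∀ {a b} → a ∧ b ≡ true → a ≡ true × b ≡ true
∧-true⁻ {true} e = refl , e

∨-true⁻ : ∀ {a b} → a ∨ b ≡ true → a ≡ true ⊎ b ≡ true
∨-true⁻ {true}  e = inj₁ refl
∨-true⁻ {false} e = inj₂ e

≤ᵇ-true⇒≤ : ∀ {m n} → (m ≤ᵇ n) ≡ true → m ≤ n
≤ᵇ-true⇒≤ {m} {n} e = ≤ᵇ⇒≤ m n (Equivalence.from T-≡ e)

≤ᵇ-false⇒> : ∀ {m n} → (m ≤ᵇ n) ≡ false → n < m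
≤ᵇ-false⇒> e = ≰⇒> λ m≤n → contradiction (trans (sym (Equivalence.to T-≡ (≤⇒≤ᵇ m≤n))) e) λ ()

≢true⇒≡false : ∀ {b} → b ≢ true → b ≡ false
≢true⇒≡false b≢true = ¬-not b≢true

anyV⁻ : ∀ {n} (p : Fin n → Bool) → anyV p ≡ true → ∃ λ x → p x ≡ true
anyV⁻ {n} p e =
  let x , px = satisfied (any⁻ p (allFin n) (Equivalence.from T-≡ e)) in x , Equivalence.to T-≡ px

anyV⁺ : ∀ {n} (p : Fin n → Bool) {x} → p x ≡ true → anyV p ≡ true
anyV⁺ p {x} px = Equivalence.to T-≡ (any⁺ p (lose (∈-allFin x) (Equivalence.from T-≡ px)))

anyV-false⁺ : ∀ {n} (p : Fin n → Bool) → (∀ x → p x ≡ false) → anyV p ≡ false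
anyV-false⁺ p none = ≢true⇒≡false λ e → let x , px = anyV⁻ p e in contradiction (trans (sym px) (none x)) λ ()

anyV-false⁻ : ∀ {n} (p : Fin n → Bool) → anyV p ≡ false → ∀ x → p x ≡ false
anyV-false⁻ p e x = ≢true⇒≡false λ px → contradiction (trans (sym (anyV⁺ p px)) e) λ ()

allV⁻ : ∀ {n} (p : Fin n → Bool) → allV p ≡ true → ∀ x → p x ≡ true
allV⁻ {n} p e x = Equivalence.to T-≡ (All-lookup (all⁺ p (allFin n) (Equivalence.from T-≡ e)) (∈-allFin x))

lookup-false⇒∉ : ∀ {n} {p : Subset n} {x} → lookup p x ≡ false → x ∉ p
lookup-false⇒∉ e x∈p = contradiction (trans (sym ([]=⇒lookup x∈p)) e) λ ()

isNonEmpty-⊥ : ∀ {n} → isNonEmpty {n} ⊥ ≡ false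
isNonEmpty-⊥ {n} = anyV-false⁺ (lookup (⊥ {n})) (λ x → lookup-replicate x false)

∈-Sources⁺ : ∀ {n} (A : Arcs n) {U : Subset n} {x} →
  x ∈ U → (∀ w → A w x ≡ false) → x ∈ Sources A U
∈-Sources⁺ A {U} {x} x∈U none = lookup⇒[]= x _ (trans (lookup∘tabulate _ x) sourceₓ)
  where
  sourceₓ : lookup U x ∧ not (anyV (λ w → lookup U w ∧ A w x)) ≡ true
  sourceₓ rewrite []=⇒lookup x∈U
                | anyV-false⁺ (λ w → lookup U w ∧ A w x) (λ w → trans (cong (_ ∧_) (none w)) (∧-zeroʳ _))
                = refl

canForce-sound : ∀ {n} (G : Graph n) (U B : Subset n) {u v} →
  canForce G U B u v ≡ true → ValidForce G U B u v
canForce-sound G U B {u} {v} e =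
  let Uu , e₁  = ∧-true⁻ {lookup U u} e
      Uv , e₂  = ∧-true⁻ {lookup U v} e₁
      Bu , e₃  = ∧-true⁻ {lookup B u} e₂
      ¬Bv , e₄ = ∧-true⁻ {not (lookup B v)} e₃
      uv , e₅  = ∧-true⁻ {adj G u v} e₄
  in lookup⇒[]= u U Uu , lookup⇒[]= v U Uv , lookup⇒[]= u B Bu ,
     lookup-false⇒∉ (not-injective ¬Bv) , uv , others-in-B e₅
  where
  others-in-B : allV (λ w → not (lookup U w ∧ adj G u w ∧ not (does (w ≟ v))) ∨ lookup B w) ≡ true →
                ∀ w → w ∈ U → adj G u w ≡ true → w ≢ v → w ∈ B
  others-in-B all w w∈U uw w≢v with ∨-true⁻ {not (lookup U w ∧ adj G u w ∧ not (does (w ≟ v)))} (allV⁻ _ all w)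
  ... | inj₂ Bw = lookup⇒[]= w B Bw
  ... | inj₁ h rewrite []=⇒lookup w∈U | uw | dec-false (w ≟ v) w≢v = contradiction h λ ()

∈-forceRound⁻ : ∀ {n} (G : Graph n) (U B : Subset n) {x} →
  x ∈ forceRound G U B → x ∈ B ⊎ ∃ λ u → ValidForce G U B u x
∈-forceRound⁻ G U B {x} x∈
  with ∨-true⁻ {lookup B x} (trans (sym (lookup∘tabulate (λ v → lookup B v ∨ anyV (λ u → canForce G U B u v)) x)) ([]=⇒lookup x∈))
... | inj₁ Bx = inj₁ (lookup⇒[]= x B Bx)
... | inj₂ some = let u , cf = anyV⁻ _ some in inj₂ (u , canForce-sound G U B cf)

White-empty⇒ : ∀ {n} (G : Graph n) (S U : Subset n) → isNonEmpty (White G S U) ≡ false →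
  ∀ {x} → x ∈ U → x ∈ iterate n (forceRound G U) (S ∩ U)
White-empty⇒ {n} G S U e {x} x∈U =
  x∉∁p⇒x∈p λ x∈∁ → lookup-false⇒∉ (anyV-false⁻ _ e x) (x∈p∩q⁺ (x∈U , x∈∁))

module _ {n} (G : Graph n) (U : Subset n) {S : Subset n}
         (nbrs : ∀ {u w} → u ∈ U → adj G u w ≡ true → w ∈ U ⊎ Blue G S w) where

  forceRound-blue : ∀ {B} → (∀ {x} → x ∈ B → Blue G S x) → ∀ {x} → x ∈ forceRound G U B → Blue G S x
  forceRound-blue {B} B-blue x∈ with ∈-forceRound⁻ G U B x∈
  ... | inj₁ x∈B = B-blue x∈B
  ... | inj₂ (u , u∈U , _ , u∈B , _ , u~x , others-in-B) = force (B-blue u∈B) u~x others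
    where
    others : ∀ w → adj G u w ≡ true → w ≢ _ → Blue G S w
    others w u~w w≢x with nbrs u∈U u~w
    ... | inj₁ w∈U = B-blue (others-in-B w w∈U u~w w≢x)
    ... | inj₂ blue = blue

  iterate-forceRound-blue : ∀ m {B} → (∀ {x} → x ∈ B → Blue G S x) →
    ∀ {x} → x ∈ iterate m (forceRound G U) B → Blue G S x
  iterate-forceRound-blue zero    B-blue = B-blue
  iterate-forceRound-blue (suc m) B-blue = iterate-forceRound-blue m (forceRound-blue B-blue)

-- Forcing schedules

Arc : ∀ {n} → Arcs n → Fin n → Fin n → Set
Arc A u v = A u v ≡ true

IsSource : ∀ {n} → Arcs n → (Fin n → Set) → Fin n → Set
IsSource A P x = P x × (∀ y → A y x ≡ false)

head-not-source : ∀ {n} {A : Arcs n} {P : Fin n → Set} {u v} → Arc A u v → ¬ IsSource A P v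
head-not-source {u = u} uv (_ , none) = contradiction (trans (sym uv) (none u)) λ ()

source-or-head : ∀ {n} (A : Arcs n) {P : Fin n → Set} {x} → P x → IsSource A P x ⊎ ∃ λ y → Arc A y x
source-or-head A {x = x} px with any? (λ y → A y x ≟ᴮ true)
... | yes arc  = inj₂ arc
... | no ¬arc = inj₁ (px , λ y → ≢true⇒≡false λ e → ¬arc (y , e))

BlueBefore : ∀ {n} → (Fin n → Fin n → Set) → (Fin n → Set) → (Fin n → Fin n → ℕ) → ℕ → Fin n → Set
BlueBefore R I time m x = I x ⊎ ∃ λ y → R y x × time y x < m

before-mono : ∀ {n} {R : Fin n → Fin n → Set} {I time m m′ x} → m ≤ m′ →
  BlueBefore R I time m x → BlueBefore R I time m′ x
before-mono m≤m′ (inj₁ i)             = inj₁ i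
before-mono m≤m′ (inj₂ (y , r , t<m)) = inj₂ (y , r , <-≤-trans t<m m≤m′)

-- A forcing process on G[P] started from I, recorded as the relation
-- R u v : "u forces v at step time u v".
record Schedule {n} (G : Graph n) (P : Fin n → Set) (R : Fin n → Fin n → Set)
                (I : Fin n → Set) : Set where
  field
    time  : Fin n → Fin n → ℕ
    bound : ℕ
    arc-edge      : ∀ {u v} → R u v → P u × P v × adj G u v ≡ true
    in-unique     : ∀ {u u' v} → R u v → R u' v → u ≡ u'
    tail-before   : ∀ {u v} → R u v → BlueBefore R I time (time u v) u
    nbr-before    : ∀ {u v} w → R u v → P w → adj G u w ≡ true → w ≢ v →
                    BlueBefore R I time (time u v) w
    head-uninit   : ∀ {u v} → R u v → ¬ I v
    time<bound    : ∀ {u v} → R u v → time u v < bound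
open Schedule

no-arc-schedule : ∀ {n} {G : Graph n} {P R I} → (∀ {u v} → ¬ R u v) → Schedule G P R I
no-arc-schedule ¬r = record
  { time = λ _ _ → 0 ; bound = 0
  ; arc-edge = ⊥-elim ∘ ¬r ; in-unique = λ r → ⊥-elim (¬r r) ; tail-before = ⊥-elim ∘ ¬r
  ; nbr-before = λ _ r → ⊥-elim (¬r r) ; head-uninit = ⊥-elim ∘ ¬r ; time<bound = ⊥-elim ∘ ¬r }

module _ {n} {G : Graph n} {P R I} (σ : Schedule G P R I) {S : Subset n}
         (initial-blue : ∀ x → I x → Blue G S x)
         (outside-blue : ∀ {u v} w → R u v → adj G u w ≡ true → P w ⊎ Blue G S w) where

  private
    forced-before : ∀ m {u v} → R u v → time σ u v < m → Blue G S v
    forced-before (suc m) {u} {v} r t<m = force (blue (tail-before σ r)) (proj₂ (proj₂ (arc-edge σ r))) others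
      where
      blue : ∀ {x} → BlueBefore R I (time σ) (time σ u v) x → Blue G S x
      blue (inj₁ i)               = initial-blue _ i
      blue (inj₂ (y , r' , t'<t)) = forced-before m r' (≤-trans t'<t (s≤s⁻¹ t<m))
      others : ∀ w → adj G u w ≡ true → w ≢ v → Blue G S w
      others w uw w≢v with outside-blue w r uw
      ... | inj₁ pw = blue (nbr-before σ w r pw uw w≢v)
      ... | inj₂ b  = b

  schedule-blue : ∀ {u v} → R u v → Blue G S v
  schedule-blue r = forced-before (bound σ) r (time<bound σ r)

schedule-resp : ∀ {n} {G : Graph n} {P R R′ I} → (∀ u v → R u v ⇔ R′ u v) →
  Schedule G P R I → Schedule G P R′ I
schedule-resp {R = R} {R′} {I} R⇔R′ σ = record
  { time        = time σ
  ; bound       = bound σ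
  ; arc-edge    = λ r → arc-edge σ (from r)
  ; in-unique   = λ r r′ → in-unique σ (from r) (from r′)
  ; tail-before = λ r → to-before (tail-before σ (from r))
  ; nbr-before  = λ w r pw u~w w≢v → to-before (nbr-before σ w (from r) pw u~w w≢v)
  ; head-uninit = λ r → head-uninit σ (from r)
  ; time<bound  = λ r → time<bound σ (from r)
  }
  where
  from : ∀ {u v} → R′ u v → R u v
  from = Equivalence.from (R⇔R′ _ _)
  to-before : ∀ {m x} → BlueBefore R I (time σ) m x → BlueBefore R′ I (time σ) m x
  to-before (inj₁ i)            = inj₁ i
  to-before (inj₂ (y , r , t<m)) = inj₂ (y , Equivalence.to (R⇔R′ y _) r , t<m)

process-schedule : ∀ {n} {G : Graph n} {U B fs} → ForcingProcess G U B fs →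
  Schedule G (_∈ U) (λ u v → (u , v) ∈ˡ fs) (_∈ B)
process-schedule (done _) = no-arc-schedule λ ()
process-schedule {n} {G} {U} {B} (step {u = u} {v} {fs} (u∈U , v∈U , u∈B , v∉B , u~v , others-in-B) rest)
  = record
  { time        = time₀
  ; bound       = suc (bound σ)
  ; arc-edge    = λ { (here refl) → u∈U , v∈U , u~v ; (there r) → arc-edge σ r }
  ; in-unique   = λ { (here refl) (here refl) → refl
                    ; (here refl) (there r)   → contradiction refl (later-head r)
                    ; (there r)   (here refl) → contradiction refl (later-head r)
                    ; (there r)   (there r′)  → in-unique σ r r′ }
  ; tail-before = λ { (here refl) → inj₁ u∈B ; (there r) → shift r (tail-before σ r) }
  ; nbr-before  = λ { w (here refl) w∈U u~w w≢v → inj₁ (others-in-B w w∈U u~w w≢v)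
                    ; w (there r) w∈U a~w w≢b → shift r (nbr-before σ w r w∈U a~w w≢b) }
  ; head-uninit = λ { (here refl) → v∉B ; (there r) b∈B → head-uninit σ r (x∈p∪q⁺ (inj₁ b∈B)) }
  ; time<bound  = λ { (here refl) → subst (_< suc (bound σ)) (sym time₀-first) (s≤s z≤n)
                    ; (there r)   → subst (_< suc (bound σ)) (sym (time₀-later (later-head r))) (s≤s (time<bound σ r)) }
  }
  where
  σ = process-schedule rest
  time₀ : Fin n → Fin n → ℕ
  time₀ a b = if does (b ≟ v) then 0 else suc (time σ a b)
  time₀-first : time₀ u v ≡ 0
  time₀-first rewrite dec-true (v ≟ v) refl = refl
  time₀-later : ∀ {a b} → b ≢ v → time₀ a b ≡ suc (time σ a b)
  time₀-later {b = b} b≢v rewrite dec-false (b ≟ v) b≢v = refl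
  later-head : ∀ {a b} → (a , b) ∈ˡ fs → b ≢ v
  later-head r refl = head-uninit σ r (x∈p∪q⁺ (inj₂ (x∈⁅x⁆ v)))
  shift : ∀ {a b x} → (a , b) ∈ˡ fs → BlueBefore (λ a b → (a , b) ∈ˡ fs) (_∈ B ∪ ⁅ v ⁆) (time σ) (time σ a b) x →
          BlueBefore (λ a b → (a , b) ∈ˡ ((u , v) ∷ fs)) (_∈ B) time₀ (time₀ a b) x
  shift {a} r (inj₁ x∈B∪v) with x∈p∪q⁻ B ⁅ v ⁆ x∈B∪v
  ... | inj₁ x∈B = inj₁ x∈B
  ... | inj₂ x∈v rewrite x∈⁅y⁆⇒x≡y v x∈v =
    inj₂ (u , here refl , subst₂ _<_ (sym time₀-first) (sym (time₀-later {a} (later-head r))) (s≤s z≤n))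
  shift {a} r (inj₂ (y , r′ , t<t)) =
    inj₂ (y , there r′ , subst₂ _<_ (sym (time₀-later {y} (later-head r′))) (sym (time₀-later {a} (later-head r))) (s≤s t<t))

fas-schedule : ∀ {n} {G : Graph n} {fas} → FASSpec G fas → ∀ S U →
  Schedule G (_∈ U) (Arc (fas S U)) (_∈ S ∩ U)
fas-schedule spec S U =
  let _ , process , fas⇔ = spec S U
  in schedule-resp (λ u v → ⇔-sym (fas⇔ u v)) (process-schedule process)

-- Reversing, pruning and gluing schedules

module _ {n} {G : Graph n} {P : Fin n → Set} {A : Arcs n}
         (σ : Schedule G P (Arc A) (IsSource A P)) where

  private
    forced-at : ∀ {v x m} → Arc A v x → BlueBefore (Arc A) (IsSource A P) (time σ) m x → time σ v x < m
    forced-at vx (inj₁ src) = contradiction src (head-not-source {A = A} {P} vx)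
    forced-at vx (inj₂ (y , yx , t<m)) with in-unique σ yx vx
    ... | refl = t<m

  out-unique : ∀ {x a b} → Arc A x a → Arc A x b → a ≡ b
  out-unique {x} {a} {b} xa xb with a ≟ b
  ... | yes a≡b = a≡b
  ... | no a≢b  = contradiction (forces-later xa xb (a≢b ∘ sym)) (<-asym (forces-later xb xa a≢b))
    where
    forces-later : ∀ {a b} → Arc A x a → Arc A x b → b ≢ a → time σ x b < time σ x a
    forces-later xa xb b≢a =
      let _ , pb , x~b = arc-edge σ xb in forced-at xb (nbr-before σ _ xa pb x~b b≢a)

  reverse-schedule : Schedule G P (Arc (reverseArcs A)) (IsSource (reverseArcs A) P)
  reverse-schedule = record
    { time        = time′
    ; bound       = suc (bound σ)
    ; arc-edge    = λ vu → let pv , pu , v~u = arc-edge σ vu in pu , pv , trans (Graph.sym G _ _) v~u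
    ; in-unique   = out-unique
    ; tail-before = λ vu → blue-before′ (proj₁ (proj₂ (arc-edge σ vu))) (λ uy → forced-at vu (tail-before σ uy))
    ; nbr-before  = nbr-before′
    ; head-uninit = head-not-source {A = reverseArcs A} {P}
    ; time<bound  = λ {u} {v} _ → s≤s (m∸n≤m (bound σ) (time σ v u))
    }
    where
    time′ : Fin n → Fin n → ℕ
    time′ u v = bound σ ∸ time σ v u

    blue-before′ : ∀ {w t} → P w → (∀ {y} → Arc A w y → t < time σ w y) →
      BlueBefore (Arc (reverseArcs A)) (IsSource (reverseArcs A) P) time′ (bound σ ∸ t) w
    blue-before′ pw later with source-or-head (reverseArcs A) {P} pw
    ... | inj₁ src     = inj₁ src
    ... | inj₂ (y , wy) = inj₂ (y , wy , ∸-monoʳ-< (later wy) (<⇒≤ (time<bound σ wy)))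

    nbr-before′ : ∀ {u v} w → Arc A v u → P w → adj G u w ≡ true → w ≢ v →
      BlueBefore (Arc (reverseArcs A)) (IsSource (reverseArcs A) P) time′ (time′ u v) w
    nbr-before′ {u} {v} w vu pw u~w w≢v = blue-before′ pw later
      where
      later : ∀ {y} → Arc A w y → time σ v u < time σ w y
      later {y} wy with y ≟ u
      ... | yes refl = contradiction (in-unique σ wy vu) w≢v
      ... | no y≢u   = forced-at vu
              (nbr-before σ u wy (proj₁ (proj₂ (arc-edge σ vu))) (trans (Graph.sym G w u) u~w) (y≢u ∘ sym))

dropArcsInto : ∀ {n} → Subset n → Arcs n → Arcs n
dropArcsInto Z A u v = A u v ∧ not (lookup Z v)

dropArcsInto⁻ : ∀ {n} (Z : Subset n) (A : Arcs n) {u v} →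
  Arc (dropArcsInto Z A) u v → Arc A u v × lookup Z v ≡ false
dropArcsInto⁻ Z A {u} {v} e with A u v | lookup Z v
... | true | false = refl , refl

drop-schedule : ∀ {n} {G : Graph n} {P : Fin n → Set} {A : Arcs n} (Z : Subset n) →
  Schedule G P (Arc A) (IsSource A P) →
  Schedule G P (Arc (dropArcsInto Z A)) (IsSource (dropArcsInto Z A) P)
drop-schedule {n} {G} {P} {A} Z σ = record
  { time        = time σ
  ; bound       = bound σ
  ; arc-edge    = λ r → arc-edge σ (kept r)
  ; in-unique   = λ r r′ → in-unique σ (kept r) (kept r′)
  ; tail-before = λ r → still-before (proj₁ (arc-edge σ (kept r))) (tail-before σ (kept r))
  ; nbr-before  = λ w r pw u~w w≢v → still-before pw (nbr-before σ w (kept r) pw u~w w≢v)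
  ; head-uninit = head-not-source {A = A′} {P}
  ; time<bound  = λ r → time<bound σ (kept r)
  }
  where
  A′ = dropArcsInto Z A
  kept : ∀ {u v} → Arc A′ u v → Arc A u v
  kept = proj₁ ∘ dropArcsInto⁻ Z A
  still-before : ∀ {m x} → P x → BlueBefore (Arc A) (IsSource A P) (time σ) m x →
                 BlueBefore (Arc A′) (IsSource A′ P) (time σ) m x
  still-before {x = x} px before with lookup Z x | before
  ... | true  | _                  = inj₁ (px , λ y → ∧-zeroʳ (A y x))
  ... | false | inj₁ (_ , none)    = inj₁ (px , λ y → cong (_∧ true) (none y))
  ... | false | inj₂ (y , yx , t<m) = inj₂ (y , cong (_∧ true) yx , t<m)

-- Run σ first and φ afterwards.  The overlap of the two vertex sets is
-- initially blue for φ, so φ never forces a vertex of P₀.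
module _ {n} {G : Graph n} {P₀ P′ P : Fin n → Set}
  (P⊆P₀∪P′ : ∀ x → P x → P₀ x ⊎ P′ x) (P₀⊆P : ∀ x → P₀ x → P x) (P′⊆P : ∀ x → P′ x → P x)
  {A : Arcs n} (σ : Schedule G P₀ (Arc A) (IsSource A P₀))
  (tail-nbrs : ∀ {u v} w → Arc A u v → adj G u w ≡ true → P₀ w)
  {F : Arcs n} {I : Fin n → Set} (φ : Schedule G P′ (Arc F) I)
  (I⊆P′ : ∀ x → I x → P′ x) (overlap-initial : ∀ x → P₀ x → P′ x → I x) where

  private
    A∪F = unionArcs A F

    time₂ : Fin n → Fin n → ℕ
    time₂ u v = if A u v then time σ u v else bound σ + time φ u v

    Before₂ : ℕ → Fin n → Set
    Before₂ = BlueBefore (Arc A∪F) (IsSource A∪F P) time₂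

    Before₂-mono : ∀ {m m′ x} → m ≤ m′ → Before₂ m x → Before₂ m′ x
    Before₂-mono = before-mono {R = Arc A∪F} {IsSource A∪F P} {time₂}

    F-head-new : ∀ {u v} → Arc F u v → ¬ P₀ v
    F-head-new uv p₀ = let _ , p′ , _ = arc-edge φ uv in head-uninit φ uv (overlap-initial _ p₀ p′)

    no-A-arc : ∀ {u v} → ¬ P₀ v → A u v ≡ false
    no-A-arc ¬p₀ = ≢true⇒≡false λ uv → ¬p₀ (proj₁ (proj₂ (arc-edge σ uv)))

    which-arc : ∀ {u v} → Arc A∪F u v → Arc A u v ⊎ (A u v ≡ false × Arc F u v)
    which-arc {u} {v} e with A u v | F u v
    ... | true  | _    = inj₁ refl
    ... | false | true = inj₂ (refl , refl)

    A-arc : ∀ {u v} → Arc A u v → Arc A∪F u v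
    A-arc uv = cong (_∨ _) uv

    F-arc : ∀ {u v} → Arc F u v → Arc A∪F u v
    F-arc {u} {v} uv rewrite uv = ∨-zeroʳ (A u v)

    time-A : ∀ {u v} → Arc A u v → time₂ u v ≡ time σ u v
    time-A uv rewrite uv = refl

    time-F : ∀ {u v} → A u v ≡ false → time₂ u v ≡ bound σ + time φ u v
    time-F ¬uv rewrite ¬uv = refl

    source : ∀ {x} → P x → (∀ y → A y x ≡ false) → (∀ y → F y x ≡ false) → IsSource A∪F P x
    source px noA noF = px , λ y → cong₂ _∨_ (noA y) (noF y)

    from-σ : ∀ {m x} → P₀ x → BlueBefore (Arc A) (IsSource A P₀) (time σ) m x → Before₂ m x
    from-σ p₀ (inj₁ (_ , noA))    = inj₁ (source (P₀⊆P _ p₀) noA (λ y → ≢true⇒≡false λ yx → F-head-new yx p₀))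
    from-σ p₀ (inj₂ (y , yx , t<m)) = inj₂ (y , A-arc yx , subst (_< _) (sym (time-A yx)) t<m)

    P₀-blue : ∀ {x} → P₀ x → Before₂ (bound σ) x
    P₀-blue p₀ with source-or-head A {P₀} p₀
    ... | inj₁ src     = from-σ p₀ (inj₁ src)
    ... | inj₂ (y , yx) = from-σ p₀ (inj₂ (y , yx , time<bound σ yx))

    I-blue : ∀ {x} → I x → Before₂ (bound σ) x
    I-blue i with source-or-head A {P′} (I⊆P′ _ i)
    ... | inj₁ (p′ , noA) = inj₁ (source (P′⊆P _ p′) noA (λ y → ≢true⇒≡false λ yx → head-uninit φ yx i))
    ... | inj₂ (y , yx)   = P₀-blue (proj₁ (proj₂ (arc-edge σ yx)))

    from-φ : ∀ {m x} → BlueBefore (Arc F) I (time φ) m x → Before₂ (bound σ + m) x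
    from-φ (inj₁ i) = Before₂-mono (m≤m+n _ _) (I-blue i)
    from-φ (inj₂ (y , yx , t<m)) =
      inj₂ (y , F-arc yx , subst (_< _) (sym (time-F (no-A-arc (F-head-new yx)))) (+-monoʳ-< _ t<m))

  glue-schedule : Schedule G P (Arc A∪F) (IsSource A∪F P)
  glue-schedule = record
    { time        = time₂
    ; bound       = bound σ + bound φ
    ; arc-edge    = arc-edge′
    ; in-unique   = in-unique′
    ; tail-before = tail-before′
    ; nbr-before  = nbr-before′
    ; head-uninit = head-not-source {A = A∪F} {P}
    ; time<bound  = time<bound′
    }
    where
    arc-edge′ : ∀ {u v} → Arc A∪F u v → P u × P v × adj G u v ≡ true
    arc-edge′ e with which-arc e
    ... | inj₁ uv       = let pu , pv , u~v = arc-edge σ uv in P₀⊆P _ pu , P₀⊆P _ pv , u~v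
    ... | inj₂ (_ , uv) = let pu , pv , u~v = arc-edge φ uv in P′⊆P _ pu , P′⊆P _ pv , u~v

    in-unique′ : ∀ {u u′ v} → Arc A∪F u v → Arc A∪F u′ v → u ≡ u′
    in-unique′ e e′ with which-arc e | which-arc e′
    ... | inj₁ uv       | inj₁ u′v       = in-unique σ uv u′v
    ... | inj₂ (_ , uv) | inj₂ (_ , u′v) = in-unique φ uv u′v
    ... | inj₁ uv       | inj₂ (_ , u′v) = contradiction (proj₁ (proj₂ (arc-edge σ uv))) (F-head-new u′v)
    ... | inj₂ (_ , uv) | inj₁ u′v       = contradiction (proj₁ (proj₂ (arc-edge σ u′v))) (F-head-new uv)

    tail-before′ : ∀ {u v} → Arc A∪F u v → Before₂ (time₂ u v) u
    tail-before′ {u} e with which-arc e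
    ... | inj₁ uv =
      subst (λ m → Before₂ m u) (sym (time-A uv)) (from-σ (proj₁ (arc-edge σ uv)) (tail-before σ uv))
    ... | inj₂ (¬uv , uv) = subst (λ m → Before₂ m u) (sym (time-F ¬uv)) (from-φ (tail-before φ uv))

    nbr-before′ : ∀ {u v} w → Arc A∪F u v → P w → adj G u w ≡ true → w ≢ v → Before₂ (time₂ u v) w
    nbr-before′ w e pw u~w w≢v with which-arc e
    ... | inj₁ uv = subst (λ m → Before₂ m w) (sym (time-A uv))
                      (from-σ (tail-nbrs w uv u~w) (nbr-before σ w uv (tail-nbrs w uv u~w) u~w w≢v))
    ... | inj₂ (¬uv , uv) with P⊆P₀∪P′ w pw
    ...   | inj₁ p₀ = subst (λ m → Before₂ m w) (sym (time-F ¬uv)) (Before₂-mono (m≤m+n _ _) (P₀-blue p₀))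
    ...   | inj₂ p′ = subst (λ m → Before₂ m w) (sym (time-F ¬uv)) (from-φ (nbr-before φ w uv p′ u~w w≢v))

    time<bound′ : ∀ {u v} → Arc A∪F u v → time₂ u v < bound σ + bound φ
    time<bound′ e with which-arc e
    ... | inj₁ uv         = subst (_< _) (sym (time-A uv)) (<-≤-trans (time<bound σ uv) (m≤m+n _ _))
    ... | inj₂ (¬uv , uv) = subst (_< _) (sym (time-F ¬uv)) (+-monoʳ-< _ (time<bound φ uv))

-- Bags of a path decomposition

InBags : ∀ {n} → (ℕ → Subset n) → ℕ → ℕ → Fin n → Set
InBags X i j x = ∃ λ s → i ≤ s × s ≤ j × x ∈ X s

module _ {n} (X : ℕ → Subset n) where

  ∈-bagUnion⁻ : ∀ i m {x} → x ∈ bagUnion X i m → ∃ λ s → s ≤ m × x ∈ X (i + s)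
  ∈-bagUnion⁻ i zero    {x} x∈ = 0 , z≤n , subst (λ j → x ∈ X j) (sym (+-identityʳ i)) x∈
  ∈-bagUnion⁻ i (suc m) x∈ with x∈p∪q⁻ (bagUnion X i m) (X (i + suc m)) x∈
  ... | inj₁ x∈′ = let s , s≤m , x∈Xs = ∈-bagUnion⁻ i m x∈′ in s , m≤n⇒m≤1+n s≤m , x∈Xs
  ... | inj₂ x∈X = suc m , ≤-refl , x∈X

  ∈-bagUnion⁺ : ∀ i m s {x} → s ≤ m → x ∈ X (i + s) → x ∈ bagUnion X i m
  ∈-bagUnion⁺ i zero    zero {x} z≤n x∈ = subst (λ j → x ∈ X j) (+-identityʳ i) x∈
  ∈-bagUnion⁺ i (suc m) s s≤1+m x∈ with m≤n⇒m<n∨m≡n s≤1+m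
  ... | inj₁ s≤m  = x∈p∪q⁺ (inj₁ (∈-bagUnion⁺ i m s (s≤s⁻¹ s≤m) x∈))
  ... | inj₂ refl = x∈p∪q⁺ (inj₂ x∈)

  ∈-bags⁻ : ∀ {i j x} → i ≤ j → x ∈ bags X i j → InBags X i j x
  ∈-bags⁻ {i} {j} i≤j x∈ =
    let s , s≤ , x∈Xs = ∈-bagUnion⁻ i (j ∸ i) x∈
    in i + s , m≤m+n i s , subst (i + s ≤_) (m+[n∸m]≡n i≤j) (+-monoʳ-≤ i s≤) , x∈Xs

  ∈-bags⁺ : ∀ {i j x} → InBags X i j x → x ∈ bags X i j
  ∈-bags⁺ {i} {j} {x} (s , i≤s , s≤j , x∈Xs) =
    ∈-bagUnion⁺ i (j ∸ i) (s ∸ i) (∸-monoˡ-≤ i s≤j) (subst (λ r → x ∈ X r) (sym (m+[n∸m]≡n i≤s)) x∈Xs)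

  bags-mono : ∀ {i j i′ j′ x} → i′ ≤ i → i ≤ j → j ≤ j′ → x ∈ bags X i j → x ∈ bags X i′ j′
  bags-mono i′≤i i≤j j≤j′ x∈ =
    let s , i≤s , s≤j , x∈Xs = ∈-bags⁻ i≤j x∈ in ∈-bags⁺ (s , ≤-trans i′≤i i≤s , ≤-trans s≤j j≤j′ , x∈Xs)

  ∈-bags-split : ∀ {t z x} → x ∈ bags X 0 z → x ∈ bags X 0 t ⊎ x ∈ bags X t z
  ∈-bags-split {t} x∈ with ∈-bags⁻ z≤n x∈
  ... | s , _ , s≤z , x∈Xs with s ≤? t
  ...   | yes s≤t = inj₁ (∈-bags⁺ (s , z≤n , s≤t , x∈Xs))
  ...   | no  s≰t = inj₂ (∈-bags⁺ (s , <⇒≤ (≰⇒> s≰t) , s≤z , x∈Xs))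

module NicePathDecompositionProperties {n} {G : Graph n} {k : ℕ} {X : ℕ → Subset n}
  (npd : NicePathDecomposition G k X) where

  private
    edges-covered = proj₁ npd
    interpolation = proj₁ (proj₂ npd)
    last-empty    = proj₁ (proj₂ (proj₂ (proj₂ npd)))
    covering      = proj₂ (proj₂ (proj₂ (proj₂ (proj₂ (proj₂ npd)))))

  ∉-last : ∀ {x} → x ∉ X (suc k)
  ∉-last x∈ = ∉⊥ (subst (_ ∈_) last-empty x∈)

  ∉-bags-last : ∀ {x} → x ∉ bags X (suc k) (suc k)
  ∉-bags-last {x} x∈ =
    let s , k<s , s≤ , x∈Xs = ∈-bags⁻ X ≤-refl x∈ in ∉-last (subst (λ r → x ∈ X r) (≤-antisym s≤ k<s) x∈Xs)

  ∈-both-sides : ∀ {t z x} → t ≤ z → z ≤ suc k → x ∈ bags X 0 t → x ∈ bags X t z → x ∈ X t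
  ∈-both-sides {t} {z} {x} t≤z z≤ x∈₁ x∈₂ with ∈-bags⁻ X z≤n x∈₁
  ... | s₁ , _ , s₁≤t , x∈Xs₁ with ∈-bags⁻ X t≤z x∈₂
  ... | s₂ , t≤s₂ , s₂≤z , x∈Xs₂ = interpolation x s₁ s₂ t s₁≤t t≤s₂ (≤-trans s₂≤z z≤) x∈Xs₁ x∈Xs₂

  nbrs-before : ∀ {t u w} → t ≤ suc k → u ∈ bags X 0 t → u ∉ X t → adj G u w ≡ true → w ∈ bags X 0 t
  nbrs-before {t} {u} {w} t≤ u∈ u∉Xt u~w with ∈-bags⁻ X z≤n u∈ | edges-covered u w u~w
  ... | s , _ , s≤t , u∈Xs | i , _ , i≤k , u∈Xi , w∈Xi with i ≤? t
  ...   | yes i≤t = ∈-bags⁺ X (i , z≤n , i≤t , w∈Xi)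
  ...   | no  i≰t = contradiction (interpolation u s i t s≤t (<⇒≤ (≰⇒> i≰t)) (m≤n⇒m≤1+n i≤k) u∈Xs u∈Xi) u∉Xt

  before-or-after : ∀ t x → x ∈ bags X 0 t ⊎ x ∈ bags X t (suc k)
  before-or-after t x with covering x
  ... | i , i≤ , x∈Xi with i ≤? t
  ...   | yes i≤t = inj₁ (∈-bags⁺ X (i , z≤n , i≤t , x∈Xi))
  ...   | no  i≰t = inj₂ (∈-bags⁺ X (i , <⇒≤ (≰⇒> i≰t) , i≤ , x∈Xi))

module Correctness {n} (G : Graph n) (k : ℕ) (X : ℕ → Subset n)
  (npd : NicePathDecomposition G k X)
  (fas : Subset n → Subset n → Arcs n) (spec : FASSpec G fas) where

  open Algorithm G k X fas
  open NicePathDecompositionProperties {G = G} {k} {X} npd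

  NoWhiteLeft : ℕ → Set
  NoWhiteLeft t = t ≡ suc k ⊎ isNonEmpty (White G (X t ∪ X (suc k)) (bags X t (suc k))) ≡ false

  L3-invariant : ℕ → ℕ → Subset n → Set
  L3-invariant t z W = (t < z × W ≡ White G (X t ∪ X z) (bags X t z)) ⊎ (z ≡ t × isNonEmpty W ≡ false)

  L3-result : ℕ → ℕ × Subset n → Set
  L3-result t (z , W) = (isNonEmpty W ≡ true × t < z × z ≤ suc k) ⊎ (isNonEmpty W ≡ false × NoWhiteLeft t)

  private
    stop-nonempty : ∀ {t z W} → isNonEmpty W ≡ true → z ≤ suc k → L3-invariant t z W → L3-result t (z , W)
    stop-nonempty ne z≤ (inj₁ (t<z , _)) = inj₁ (ne , t<z , z≤)
    stop-nonempty ne z≤ (inj₂ (_ , e))   = contradiction (trans (sym ne) e) λ ()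

    stop-empty : ∀ {t z W} → isNonEmpty W ≡ false → z ≡ suc k → L3-invariant t z W → L3-result t (z , W)
    stop-empty e refl (inj₁ (_ , refl)) = inj₂ (e , inj₂ e)
    stop-empty e z≡  (inj₂ (z≡t , _))  = inj₂ (e , inj₁ (trans (sym z≡t) z≡))

  loopL3-result : ∀ t fuel z W → t ≤ z → z ≤ suc k → suc k ≤ fuel + z → L3-invariant t z W →
    L3-result t (loopL3 fuel t z W)
  loopL3-result t zero z W t≤z z≤ ≤z inv = stop (isNonEmpty W) refl
    where
    stop : ∀ b → isNonEmpty W ≡ b → L3-result t (z , W)
    stop true  e = stop-nonempty e z≤ inv
    stop false e = stop-empty e (≤-antisym z≤ ≤z) inv
  loopL3-result t (suc fuel) z W t≤z z≤ ≤fuel+z inv = continue (isNonEmpty W) refl (z ≤ᵇ k) refl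
    where
    continue : ∀ b → isNonEmpty W ≡ b → ∀ c → (z ≤ᵇ k) ≡ c →
      L3-result t (if b ∨ not c then (z , W)
                   else loopL3 fuel t (suc z) (White G (X t ∪ X (suc z)) (bags X t (suc z))))
    continue true  e _     _   = stop-nonempty e z≤ inv
    continue false e false z≰k = stop-empty e (≤-antisym z≤ (≤ᵇ-false⇒> z≰k)) inv
    continue false e true  z≤k = loopL3-result t fuel (suc z) _ (m≤n⇒m≤1+n t≤z) (s≤s (≤ᵇ-true⇒≤ z≤k))
                                   (subst (suc k ≤_) (sym (+-suc fuel z)) ≤fuel+z) (inj₁ (s≤s t≤z , refl))

  Invariant : ℕ → Arcs n → Set
  Invariant t A = Schedule G (_∈ bags X 0 t) (Arc A) (IsSource A (_∈ bags X 0 t)) ×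
                  (∀ {u v} → Arc A u v → v ∉ X t)

  invariant-start : Invariant 0 noArcs
  invariant-start = no-arc-schedule (λ ()) , λ ()

  gluedArcs nextArcs : ℕ → ℕ → Arcs n → Arcs n
  gluedArcs t z A = unionArcs (reverseArcs A) (fas (X t ∪ X (z ∸ 1)) (bags X t z))
  nextArcs  t z A = dropArcsInto (X z) (gluedArcs t z A)

  invariant-step : ∀ {t z A} → t < z → z ≤ suc k → Invariant t A → Invariant z (nextArcs t z A)
  invariant-step {t} {z} {A} t<z z≤ (σ , heads∉Xt) =
    drop-schedule (X z) glued , λ uv → lookup-false⇒∉ (proj₂ (dropArcsInto⁻ (X z) (gluedArcs t z A) uv))
    where
    t≤z = <⇒≤ t<z
    glued : Schedule G (_∈ bags X 0 z) (Arc (gluedArcs t z A)) (IsSource (gluedArcs t z A) (_∈ bags X 0 z))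
    glued = glue-schedule {P₀ = _∈ bags X 0 t} {_∈ bags X t z}
      (λ _ → ∈-bags-split X {t} {z}) (λ _ → bags-mono X ≤-refl z≤n t≤z) (λ _ → bags-mono X z≤n t≤z ≤-refl)
      (reverse-schedule σ)
      (λ w vu u~w → nbrs-before (≤-trans t≤z z≤) (proj₁ (proj₂ (arc-edge σ vu))) (heads∉Xt vu) u~w)
      (fas-schedule spec (X t ∪ X (z ∸ 1)) (bags X t z))
      (λ x x∈ → proj₂ (x∈p∩q⁻ _ _ x∈))
      (λ x x∈₁ x∈₂ → x∈p∩q⁺ (x∈p∪q⁺ (inj₁ (∈-both-sides t≤z z≤ x∈₁ x∈₂)) , x∈₂))

  sources-blue : ∀ {t A} → t ≤ suc k → Invariant t A →
    ∀ {x} → x ∈ bags X 0 t → Blue G (Sources (reverseArcs A) (bags X 0 t)) x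
  sources-blue {t} {A} t≤ (σ , heads∉Xt) x∈ with source-or-head (reverseArcs A) {_∈ bags X 0 t} x∈
  ... | inj₁ (_ , none) = init (∈-Sources⁺ (reverseArcs A) x∈ none)
  ... | inj₂ (_ , yx)   = schedule-blue (reverse-schedule σ)
          (λ x (x∈ , none) → init (∈-Sources⁺ (reverseArcs A) x∈ none))
          (λ w vu u~w → inj₁ (nbrs-before t≤ (proj₁ (proj₂ (arc-edge σ vu))) (heads∉Xt vu) u~w)) yx

  all-blue : ∀ {t A} → t ≤ suc k → Invariant t A → NoWhiteLeft t →
    ZeroForcingSet G (Sources (reverseArcs A) (bags X 0 t))
  all-blue {t} {A} t≤ inv none-white x with before-or-after t x
  ... | inj₁ x∈ = sources-blue t≤ inv x∈
  ... | inj₂ x∈ with none-white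
  ...   | inj₁ refl  = contradiction x∈ ∉-bags-last
  ...   | inj₂ empty = iterate-forceRound-blue G U nbrs n initial-blue (White-empty⇒ G (X t ∪ X (suc k)) U empty x∈)
    where
    U = bags X t (suc k)
    nbrs : ∀ {u w} → u ∈ U → adj G u w ≡ true → w ∈ U ⊎ Blue G (Sources (reverseArcs A) (bags X 0 t)) w
    nbrs {w = w} _ _ with before-or-after t w
    ... | inj₁ w∈ = inj₂ (sources-blue t≤ inv w∈)
    ... | inj₂ w∈ = inj₁ w∈
    initial-blue : ∀ {y} → y ∈ (X t ∪ X (suc k)) ∩ U → Blue G (Sources (reverseArcs A) (bags X 0 t)) y
    initial-blue y∈ with x∈p∪q⁻ (X t) (X (suc k)) (proj₁ (x∈p∩q⁻ _ U y∈))
    ... | inj₁ y∈Xt = sources-blue t≤ inv (∈-bags⁺ X (t , z≤n , ≤-refl , y∈Xt))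
    ... | inj₂ y∈Xk = contradiction y∈Xk ∉-last

  run-blue : ∀ fuel t A S F → t ≤ suc k → suc k ≤ fuel + t → Invariant t A →
    ZeroForcingSet G (proj₁ (run (suc fuel) t A S F))
  run-blue fuel t A S F t≤ ≤fuel+t inv
    with loopL3 (suc k) t t ⊥ | loopL3-result t (suc k) t ⊥ ≤-refl t≤ (m≤m+n _ _) (inj₂ (refl , isNonEmpty-⊥ {n}))
  ... | z , W | inj₂ (empty , none-white) rewrite empty = all-blue t≤ inv none-white
  ... | z , W | inj₁ (nonempty , t<z , z≤) rewrite nonempty with fuel
  ...   | zero       = contradiction (<-≤-trans t<z (≤-trans z≤ ≤fuel+t)) (<-irrefl refl)
  ...   | suc fuel′  =
    run-blue fuel′ z (nextArcs t z A) (Sources (reverseArcs A) (bags X 0 t) ∪ X (z ∸ 1)) (F ++ (W ∷ []))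
             z≤ (≤-trans ≤fuel+t (+-monoʳ-< fuel′ t<z)) (invariant-step t<z z≤ inv)

theorem4p8 : ∀ {n : ℕ} (G : Graph n) (k : ℕ) (X : ℕ → Subset n) →
    NicePathDecomposition G k X →
    (fas : Subset n → Subset n → Arcs n) → FASSpec G fas →
    ZeroForcingSet G (proj₁ (zfsAlgorithm G k X fas))
theorem4p8 G k X npd fas spec =
  run-blue (suc k) 0 noArcs ⊥ [] z≤n (m≤m+n (suc k) 0) invariant-start
  where open Correctness G k X npd fas spec
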